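{- Let $A\in\mathbb{R}^{n\times n}$ be a symmetric matrix such that $\mathrm{diag}(A)=c\cdot A\mathbf{1}$ for some $c\in\mathbb{R}$. Then $R(A)$ is positive semidefinite if and only if $A$ is positive semidefinite and $\mathbf{1}^{\mathsf{T}}A\mathbf{1}\geq(\mathrm{tr}\,A)^2$.
   Context: For a symmetric $A\in\mathbb{R}^{n\times n}$, $R(A)$ is the $(n+1)\times(n+1)$ symmetric matrix $\begin{pmatrix}1&a^{\mathsf{T}}\\ a&A\end{pmatrix}$ with $a=\mathrm{diag}(A)$ the vector of diagonal entries of $A$. $\mathbf{1}$ is the all-one vector. -}

module Defs where

open import Level using (0ℓ)
open import Data.Nat using (ℕ; zero; suc)
open import Data.Fin using (Fin; zero; suc)
open import Data.Product using (Σ; ∃; _×_)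
open import Relation.Binary.PropositionalEquality using (_≡_; _≢_)
open import Relation.Binary.Structures using (IsTotalOrder)
open import Algebra.Structures using (IsCommutativeRing)

record RealField : Set₁ where
  infixl 6 _+_
  infixl 7 _*_
  infix 4 _≤_
  field
    ℝ     : Set
    _+_   : ℝ → ℝ → ℝ
    _*_   : ℝ → ℝ → ℝ
    -_    : ℝ → ℝ
    0ℝ    : ℝ
    1ℝ    : ℝ
    _≤_   : ℝ → ℝ → Set
    isCommutativeRing : IsCommutativeRing _≡_ _+_ _*_ -_ 0ℝ 1ℝ
    0≢1   : 0ℝ ≢ 1ℝ
    inverse : ∀ x → x ≢ 0ℝ → Σ ℝ (λ y → x * y ≡ 1ℝ)
    isTotalOrder : IsTotalOrder _≡_ _≤_
    +-mono-≤ : ∀ {x y} z → x ≤ y → x + z ≤ y + z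
    *-nonneg : ∀ {x y} → 0ℝ ≤ x → 0ℝ ≤ y → 0ℝ ≤ x * y
    sup : (P : ℝ → Set) → ∃ P → (∃ λ b → ∀ x → P x → x ≤ b) →
          ∃ λ s → (∀ x → P x → x ≤ s) × (∀ b → (∀ x → P x → x ≤ b) → s ≤ b)

module Matrices (R : RealField) where
  open RealField R

  Matrix : ℕ → Set
  Matrix n = Fin n → Fin n → ℝ

  Vector : ℕ → Set
  Vector n = Fin n → ℝ

  ∑ : ∀ n → (Fin n → ℝ) → ℝ
  ∑ zero    f = 0ℝ
  ∑ (suc n) f = f zero + ∑ n (λ i → f (suc i))

  Symmetric : ∀ {n} → Matrix n → Set
  Symmetric A = ∀ i j → A i j ≡ A j i

  quadForm : ∀ {n} → Matrix n → Vector n → ℝ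
  quadForm {n} A x = ∑ n (λ i → ∑ n (λ j → x i * A i j * x j))

  PSD : ∀ {n} → Matrix n → Set
  PSD A = Symmetric A × (∀ x → 0ℝ ≤ quadForm A x)

  diag : ∀ {n} → Matrix n → Vector n
  diag A i = A i i

  mulOnes : ∀ {n} → Matrix n → Vector n
  mulOnes {n} A i = ∑ n (λ j → A i j)

  onesForm : ∀ {n} → Matrix n → ℝ
  onesForm {n} A = ∑ n (λ i → ∑ n (λ j → A i j))

  tr : ∀ {n} → Matrix n → ℝ
  tr {n} A = ∑ n (λ i → A i i)

  -- R(A) = [[1, aᵀ], [a, A]] with a = diag A
  Rmat : ∀ {n} → Matrix n → Matrix (suc n)
  Rmat A zero    zero    = 1ℝ
  Rmat A zero    (suc j) = diag A j
  Rmat A (suc i) zero    = diag A i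
  Rmat A (suc i) (suc j) = A i j

-- Write b(y) = aᵀy and w(y) = yᵀA𝟏.  Completing the square,
--     (x₀, y)ᵀ R(A) (x₀, y) = (x₀ + b(y))² + (yᵀAy − b(y)²),
-- so R(A) ⪰ 0 iff A is symmetric and b(y)² ≤ yᵀAy for every y (a Schur
-- complement statement, valid for every A).  Under diag A = c·A𝟏 we have
-- b(y) = c·w(y) and tr A = c·s with s = 𝟏ᵀA𝟏, so
--   (⇒) y = 𝟏 gives tr(A)² ≤ s, and b(y)² ≤ yᵀAy forces yᵀAy ≥ 0;
--   (⇐) tr(A)² ≤ s says (cs)² ≤ s, whence c²s ≤ 1, and since the quadratic
--       t ↦ (y + t𝟏)ᵀA(y + t𝟏) = yᵀAy + 2t·w(y) + t²s is nonnegative,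
--       evaluating it at t = −c²w(y) yields c²w(y)² ≤ yᵀAy.
module Submission where

open import Defs
open import Data.Nat using (ℕ)
open import Data.Product using (Σ; _×_)
open import Relation.Binary.PropositionalEquality using (_≡_)
open import Function.Bundles using (_⇔_)
open import Level using (0ℓ)
open import Data.Nat as N using (zero; suc)
import Data.Nat.Properties as NP
open import Data.Fin using (Fin; zero; suc)
open import Data.Integer as Z using (ℤ; -[1+_]) renaming (+_ to pos)
import Data.Integer.Properties as ZP
open import Data.Sign as S using (Sign)
open import Data.Maybe as Maybe using (Maybe)
open import Data.Product using (_,_)
open import Data.Sum using (inj₁; inj₂)
open import Data.Vec.Functional using (_∷_; head; tail)
open import Algebra.Bundles using (CommutativeRing; RawRing)
import Algebra.Solver.Ring.AlmostCommutativeRing as ACR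
open import Relation.Binary.Consequences using (dec⇒weaklyDec)
open import Relation.Binary.PropositionalEquality
  using (_≢_; refl; sym; trans; cong; cong₂; subst; subst₂; module ≡-Reasoning)
open import Relation.Binary.Structures using (IsTotalOrder)
open import Function.Bundles using (mk⇔; Equivalence)

-- A ring solver for the field of a RealField.  Its normal forms have
-- integer coefficients, interpreted through the canonical map ℤ → ℝ, so
-- that cancellations such as x − x = 0 are detected.
module IntegerCoefficients (R : RealField) where
  open RealField R

  commutativeRing : CommutativeRing 0ℓ 0ℓ
  commutativeRing = record { isCommutativeRing = isCommutativeRing }

  open CommutativeRing commutativeRing public
    using ( +-assoc; +-comm; *-assoc; *-comm; +-identityˡ; +-identityʳ
          ; *-identityˡ; *-identityʳ; -‿inverseʳ; distribˡ; distribʳ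
          ; zeroˡ; zeroʳ)
  open import Algebra.Properties.Ring (CommutativeRing.ring commutativeRing)
    using (-‿involutive; -‿+-comm; -0#≈0#; -‿distribˡ-*; -‿distribʳ-*)

  infixl 6 _-_
  _-_ : ℝ → ℝ → ℝ
  x - y = x + - y

  -- ℕ → ℝ, arranged so that the image of 1 is 1ℝ itself; this keeps the
  -- solver's constant 1 definitionally equal to 1ℝ.
  natR : ℕ → ℝ
  natR zero          = 0ℝ
  natR (suc zero)    = 1ℝ
  natR (suc (suc n)) = 1ℝ + natR (suc n)

  natR-suc : ∀ n → natR (suc n) ≡ 1ℝ + natR n
  natR-suc zero    = sym (+-identityʳ 1ℝ)
  natR-suc (suc n) = refl

  natR-+ : ∀ m n → natR (m N.+ n) ≡ natR m + natR n
  natR-+ zero    n = sym (+-identityˡ _)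
  natR-+ (suc m) n = begin
    natR (suc (m N.+ n))    ≡⟨ natR-suc (m N.+ n) ⟩
    1ℝ + natR (m N.+ n)     ≡⟨ cong (1ℝ +_) (natR-+ m n) ⟩
    1ℝ + (natR m + natR n)  ≡⟨ sym (+-assoc _ _ _) ⟩
    (1ℝ + natR m) + natR n  ≡⟨ cong (_+ natR n) (sym (natR-suc m)) ⟩
    natR (suc m) + natR n   ∎
    where open ≡-Reasoning

  natR-* : ∀ m n → natR (m N.* n) ≡ natR m * natR n
  natR-* zero    n = sym (zeroˡ _)
  natR-* (suc m) n = begin
    natR (n N.+ m N.* n)           ≡⟨ natR-+ n (m N.* n) ⟩
    natR n + natR (m N.* n)        ≡⟨ cong₂ _+_ (sym (*-identityˡ _)) (natR-* m n) ⟩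
    1ℝ * natR n + natR m * natR n  ≡⟨ sym (distribʳ _ _ _) ⟩
    (1ℝ + natR m) * natR n         ≡⟨ cong (_* natR n) (sym (natR-suc m)) ⟩
    natR (suc m) * natR n          ∎
    where open ≡-Reasoning

  ⟦_⟧ᶻ : ℤ → ℝ
  ⟦ pos n    ⟧ᶻ = natR n
  ⟦ -[1+ n ] ⟧ᶻ = - natR (suc n)

  difference-shift : ∀ a b → a - b ≡ (1ℝ + a) - (1ℝ + b)
  difference-shift a b = begin
    a - b                        ≡⟨ sym (+-identityˡ _) ⟩
    0ℝ + (a - b)                 ≡⟨ cong (_+ (a - b)) (sym (-‿inverseʳ 1ℝ)) ⟩
    (1ℝ - 1ℝ) + (a - b)          ≡⟨ +-assoc _ _ _ ⟩
    1ℝ + (- 1ℝ + (a - b))        ≡⟨ cong (1ℝ +_) (sym (+-assoc _ _ _)) ⟩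
    1ℝ + ((- 1ℝ + a) - b)        ≡⟨ cong (λ z → 1ℝ + (z - b)) (+-comm _ _) ⟩
    1ℝ + ((a - 1ℝ) - b)          ≡⟨ cong (1ℝ +_) (+-assoc _ _ _) ⟩
    1ℝ + (a + (- 1ℝ - b))        ≡⟨ sym (+-assoc _ _ _) ⟩
    (1ℝ + a) + (- 1ℝ - b)        ≡⟨ cong ((1ℝ + a) +_) (-‿+-comm _ _) ⟩
    (1ℝ + a) - (1ℝ + b)          ∎
    where open ≡-Reasoning

  ⊖-hom : ∀ m n → ⟦ m Z.⊖ n ⟧ᶻ ≡ natR m - natR n
  ⊖-hom zero    zero    = sym (-‿inverseʳ 0ℝ)
  ⊖-hom zero    (suc n) = sym (+-identityˡ _)
  ⊖-hom (suc m) zero    = sym (trans (cong (natR (suc m) +_) -0#≈0#) (+-identityʳ _))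
  ⊖-hom (suc m) (suc n) = begin
    ⟦ suc m Z.⊖ suc n ⟧ᶻ           ≡⟨ cong ⟦_⟧ᶻ (ZP.[1+m]⊖[1+n]≡m⊖n m n) ⟩
    ⟦ m Z.⊖ n ⟧ᶻ                   ≡⟨ ⊖-hom m n ⟩
    natR m - natR n                ≡⟨ difference-shift (natR m) (natR n) ⟩
    (1ℝ + natR m) - (1ℝ + natR n)  ≡⟨ sym (cong₂ _-_ (natR-suc m) (natR-suc n)) ⟩
    natR (suc m) - natR (suc n)    ∎
    where open ≡-Reasoning

  +-hom : ∀ i j → ⟦ i Z.+ j ⟧ᶻ ≡ ⟦ i ⟧ᶻ + ⟦ j ⟧ᶻ
  +-hom (pos m)  (pos n)  = natR-+ m n
  +-hom (pos m)  -[1+ n ] = ⊖-hom m (suc n)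
  +-hom -[1+ m ] (pos n)  = trans (⊖-hom n (suc m)) (+-comm _ _)
  +-hom -[1+ m ] -[1+ n ] = begin
    - natR (suc (suc (m N.+ n)))        ≡⟨ cong (λ k → - natR (suc k)) (sym (NP.+-suc m n)) ⟩
    - natR (suc m N.+ suc n)            ≡⟨ cong -_ (natR-+ (suc m) (suc n)) ⟩
    - (natR (suc m) + natR (suc n))     ≡⟨ sym (-‿+-comm _ _) ⟩
    - natR (suc m) + - natR (suc n)     ∎
    where open ≡-Reasoning

  neg-hom : ∀ i → ⟦ Z.- i ⟧ᶻ ≡ - ⟦ i ⟧ᶻ
  neg-hom (pos zero)    = sym -0#≈0#
  neg-hom (pos (suc n)) = refl
  neg-hom -[1+ n ]      = sym (-‿involutive _)

  -- Multiplication of integers is sign times magnitude, so the map is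
  -- checked on signs and on magnitudes separately.
  sgn : Sign → ℝ
  sgn S.+ = 1ℝ
  sgn S.- = - 1ℝ

  sgn-* : ∀ s t → sgn (s S.* t) ≡ sgn s * sgn t
  sgn-* S.+ t   = sym (*-identityˡ _)
  sgn-* S.- S.+ = sym (*-identityʳ _)
  sgn-* S.- S.- = begin
    1ℝ              ≡⟨ sym (-‿involutive 1ℝ) ⟩
    - (- 1ℝ)        ≡⟨ cong -_ (sym (*-identityʳ _)) ⟩
    - (- 1ℝ * 1ℝ)   ≡⟨ -‿distribʳ-* _ _ ⟩
    - 1ℝ * - 1ℝ     ∎
    where open ≡-Reasoning

  ◃-hom : ∀ s n → ⟦ s Z.◃ n ⟧ᶻ ≡ sgn s * natR n
  ◃-hom s   zero    = sym (zeroʳ _)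
  ◃-hom S.+ (suc n) = sym (*-identityˡ _)
  ◃-hom S.- (suc n) = trans (cong -_ (sym (*-identityˡ _))) (-‿distribˡ-* _ _)

  sign-magnitude : ∀ i → ⟦ i ⟧ᶻ ≡ sgn (Z.sign i) * natR Z.∣ i ∣
  sign-magnitude (pos n)  = sym (*-identityˡ _)
  sign-magnitude -[1+ n ] = ◃-hom S.- (suc n)

  *-hom : ∀ i j → ⟦ i Z.* j ⟧ᶻ ≡ ⟦ i ⟧ᶻ * ⟦ j ⟧ᶻ
  *-hom i j = begin
    ⟦ i Z.* j ⟧ᶻ                           ≡⟨ ◃-hom (σ S.* τ) (a N.* b) ⟩
    sgn (σ S.* τ) * natR (a N.* b)          ≡⟨ cong₂ _*_ (sgn-* σ τ) (natR-* a b) ⟩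
    (sgn σ * sgn τ) * (natR a * natR b)     ≡⟨ *-assoc _ _ _ ⟩
    sgn σ * (sgn τ * (natR a * natR b))     ≡⟨ cong (sgn σ *_) (sym (*-assoc _ _ _)) ⟩
    sgn σ * ((sgn τ * natR a) * natR b)     ≡⟨ cong (λ z → sgn σ * (z * natR b)) (*-comm _ _) ⟩
    sgn σ * ((natR a * sgn τ) * natR b)     ≡⟨ cong (sgn σ *_) (*-assoc _ _ _) ⟩
    sgn σ * (natR a * (sgn τ * natR b))     ≡⟨ sym (*-assoc _ _ _) ⟩
    (sgn σ * natR a) * (sgn τ * natR b)     ≡⟨ sym (cong₂ _*_ (sign-magnitude i) (sign-magnitude j)) ⟩
    ⟦ i ⟧ᶻ * ⟦ j ⟧ᶻ                         ∎
    where
    open ≡-Reasoning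
    σ = Z.sign i
    τ = Z.sign j
    a = Z.∣ i ∣
    b = Z.∣ j ∣

  almostCommutativeRing : ACR.AlmostCommutativeRing 0ℓ 0ℓ
  almostCommutativeRing = ACR.fromCommutativeRing commutativeRing

  ℤ-rawRing : RawRing 0ℓ 0ℓ
  ℤ-rawRing = CommutativeRing.rawRing ZP.+-*-commutativeRing

  ℤ⟶ℝ : ℤ-rawRing ACR.-Raw-AlmostCommutative⟶ almostCommutativeRing
  ℤ⟶ℝ = record
    { ⟦_⟧ = ⟦_⟧ᶻ ; +-homo = +-hom ; *-homo = *-hom ; -‿homo = neg-hom
    ; 0-homo = refl ; 1-homo = refl }

  equal-coefficients : ∀ i j → Maybe (⟦ i ⟧ᶻ ≡ ⟦ j ⟧ᶻ)
  equal-coefficients i j = Maybe.map (cong ⟦_⟧ᶻ) (dec⇒weaklyDec ZP._≟_ i j)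

  open import Algebra.Solver.Ring ℤ-rawRing almostCommutativeRing ℤ⟶ℝ equal-coefficients public

module OrderedField (R : RealField) where
  open RealField R
  open IntegerCoefficients R
  open IsTotalOrder isTotalOrder public
    using (antisym; total; reflexive) renaming (trans to ≤-trans)

  ≤⇒0≤diff : ∀ {x y} → x ≤ y → 0ℝ ≤ y - x
  ≤⇒0≤diff {x} {y} x≤y = subst (_≤ y - x) (-‿inverseʳ x) (+-mono-≤ (- x) x≤y)

  0≤diff⇒≤ : ∀ {x y} → 0ℝ ≤ y - x → x ≤ y
  0≤diff⇒≤ {x} {y} 0≤y-x =
    subst₂ _≤_ (+-identityˡ x) (solve 2 (λ x y → (y :- x) :+ x := y) refl x y)
      (+-mono-≤ x 0≤y-x)

  +-nonneg : ∀ {x y} → 0ℝ ≤ x → 0ℝ ≤ y → 0ℝ ≤ x + y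
  +-nonneg {x} {y} 0≤x 0≤y =
    ≤-trans (subst (0ℝ ≤_) (sym (+-identityˡ y)) 0≤y) (+-mono-≤ y 0≤x)

  square-nonneg : ∀ x → 0ℝ ≤ x * x
  square-nonneg x with total 0ℝ x
  ... | inj₁ 0≤x = *-nonneg 0≤x 0≤x
  ... | inj₂ x≤0 = subst (0ℝ ≤_) (solve 1 (λ x → (:- x) :* (:- x) := x :* x) refl x)
                     (*-nonneg 0≤-x 0≤-x)
    where
    0≤-x : 0ℝ ≤ - x
    0≤-x = subst (0ℝ ≤_) (+-identityˡ (- x)) (≤⇒0≤diff x≤0)

  0≤1 : 0ℝ ≤ 1ℝ
  0≤1 = subst (0ℝ ≤_) (*-identityˡ 1ℝ) (square-nonneg 1ℝ)

  nonneg-nonpos⇒0 : ∀ {z} → 0ℝ ≤ z → 0ℝ ≤ - z → z ≡ 0ℝ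
  nonneg-nonpos⇒0 {z} 0≤z 0≤-z =
    antisym (0≤diff⇒≤ (subst (0ℝ ≤_) (sym (+-identityˡ (- z))) 0≤-z)) 0≤z

  nonzero-cancel : ∀ {x y} → x ≢ 0ℝ → x * y ≡ 0ℝ → y ≡ 0ℝ
  nonzero-cancel {x} {y} x≢0 xy≡0 with inverse x x≢0
  ... | v , xv≡1 = begin
    y             ≡⟨ sym (*-identityˡ y) ⟩
    1ℝ * y        ≡⟨ cong (_* y) (sym xv≡1) ⟩
    (x * v) * y   ≡⟨ solve 3 (λ x v y → (x :* v) :* y := v :* (x :* y)) refl x v y ⟩
    v * (x * y)   ≡⟨ cong (v *_) xy≡0 ⟩
    v * 0ℝ        ≡⟨ zeroʳ v ⟩
    0ℝ            ∎
    where open ≡-Reasoning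

  -- If s ≥ 0 and (cs)² ≤ s then c²s ≤ 1.  (For s > 0 divide by s; the
  -- argument below avoids division: c²s ≥ 1 forces (c²s − 1)s = 0.)
  scaled-bound : ∀ c s → 0ℝ ≤ s → (c * s) * (c * s) ≤ s → c * c * s ≤ 1ℝ
  scaled-bound c s 0≤s cs²≤s with total (c * c * s) 1ℝ
  ... | inj₁ u≤1 = u≤1
  ... | inj₂ 1≤u = reflexive u≡1
    where
    u = c * c * s

    excess≡0 : (u - 1ℝ) * s ≡ 0ℝ
    excess≡0 = nonneg-nonpos⇒0 (*-nonneg (≤⇒0≤diff 1≤u) 0≤s)
      (subst (0ℝ ≤_)
        (solve 2 (λ c s → s :- (c :* s) :* (c :* s)
                          := :- ((c :* c :* s :- con (pos 1)) :* s)) refl c s)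
        (≤⇒0≤diff cs²≤s))

    u≢0 : u ≢ 0ℝ
    u≢0 u≡0 = 0≢1 (antisym 0≤1 (subst (1ℝ ≤_) u≡0 1≤u))

    u·excess≡0 : u * (u - 1ℝ) ≡ 0ℝ
    u·excess≡0 = begin
      u * (u - 1ℝ)           ≡⟨ solve 2 (λ c s → (c :* c :* s) :* (c :* c :* s :- con (pos 1))
                                          := c :* c :* ((c :* c :* s :- con (pos 1)) :* s)) refl c s ⟩
      c * c * ((u - 1ℝ) * s) ≡⟨ cong (c * c *_) excess≡0 ⟩
      c * c * 0ℝ             ≡⟨ zeroʳ _ ⟩
      0ℝ                     ∎
      where open ≡-Reasoning

    u≡1 : u ≡ 1ℝ
    u≡1 = begin
      u                ≡⟨ solve 1 (λ u → u := (u :- con (pos 1)) :+ con (pos 1)) refl u ⟩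
      (u - 1ℝ) + 1ℝ    ≡⟨ cong (_+ 1ℝ) (nonzero-cancel u≢0 u·excess≡0) ⟩
      0ℝ + 1ℝ          ≡⟨ +-identityˡ 1ℝ ⟩
      1ℝ               ∎
      where open ≡-Reasoning

  -- If the quadratic t ↦ q + 2wt + st² is nonnegative and c²s ≤ 1, then
  -- (cw)² ≤ q: evaluate at t = −c²w and add the slack (cw)²(1 − c²s) ≥ 0.
  quadratic-bound : ∀ q w s c → (∀ t → 0ℝ ≤ q + t * (w + w) + t * t * s) →
                    c * c * s ≤ 1ℝ → (c * w) * (c * w) ≤ q
  quadratic-bound q w s c nonneg c²s≤1 =
    0≤diff⇒≤ (subst (0ℝ ≤_) value (+-nonneg (nonneg t) slack))
    where
    t = - (c * c * w)

    slack : 0ℝ ≤ (c * w) * (c * w) * (1ℝ - c * c * s)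
    slack = *-nonneg (square-nonneg (c * w)) (≤⇒0≤diff c²s≤1)

    value : q + t * (w + w) + t * t * s + (c * w) * (c * w) * (1ℝ - c * c * s)
            ≡ q - (c * w) * (c * w)
    value = solve 4 (λ q w s c →
        q :+ (:- (c :* c :* w)) :* (w :+ w) :+ (:- (c :* c :* w)) :* (:- (c :* c :* w)) :* s
          :+ (c :* w) :* (c :* w) :* (con (pos 1) :- c :* c :* s)
        := q :- (c :* w) :* (c :* w)) refl q w s c

module FiniteSums (R : RealField) where
  open RealField R
  open IntegerCoefficients R
  open Matrices R

  ∑-cong : ∀ n {f g : Fin n → ℝ} → (∀ i → f i ≡ g i) → ∑ n f ≡ ∑ n g
  ∑-cong zero    f≗g = refl
  ∑-cong (suc n) f≗g = cong₂ _+_ (f≗g zero) (∑-cong n (λ i → f≗g (suc i)))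

  ∑-zero : ∀ n → ∑ n (λ _ → 0ℝ) ≡ 0ℝ
  ∑-zero zero    = refl
  ∑-zero (suc n) = trans (cong (0ℝ +_) (∑-zero n)) (+-identityˡ 0ℝ)

  ∑-+ : ∀ n (f g : Fin n → ℝ) → ∑ n (λ i → f i + g i) ≡ ∑ n f + ∑ n g
  ∑-+ zero    f g = sym (+-identityˡ 0ℝ)
  ∑-+ (suc n) f g = trans (cong ((f zero + g zero) +_) (∑-+ n _ _))
    (solve 4 (λ a b c d → (a :+ b) :+ (c :+ d) := (a :+ c) :+ (b :+ d)) refl _ _ _ _)

  ∑-*ˡ : ∀ n c (f : Fin n → ℝ) → ∑ n (λ i → c * f i) ≡ c * ∑ n f
  ∑-*ˡ zero    c f = sym (zeroʳ c)
  ∑-*ˡ (suc n) c f = trans (cong ((c * f zero) +_) (∑-*ˡ n c _)) (sym (distribˡ _ _ _))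

  ∑-swap : ∀ n m (f : Fin n → Fin m → ℝ) →
           ∑ n (λ i → ∑ m (f i)) ≡ ∑ m (λ j → ∑ n (λ i → f i j))
  ∑-swap zero    m f = sym (∑-zero m)
  ∑-swap (suc n) m f = begin
    ∑ m (f zero) + ∑ n (λ i → ∑ m (f (suc i)))
      ≡⟨ cong (∑ m (f zero) +_) (∑-swap n m (λ i → f (suc i))) ⟩
    ∑ m (f zero) + ∑ m (λ j → ∑ n (λ i → f (suc i) j)) ≡⟨ sym (∑-+ m _ _) ⟩
    ∑ m (λ j → f zero j + ∑ n (λ i → f (suc i) j))     ∎
    where open ≡-Reasoning

  ∑-quadratic : ∀ n t (f g h : Fin n → ℝ) →
    ∑ n (λ i → f i + t * g i + t * t * h i) ≡ ∑ n f + t * ∑ n g + t * t * ∑ n h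
  ∑-quadratic n t f g h = begin
    ∑ n (λ i → f i + t * g i + t * t * h i)              ≡⟨ ∑-+ n _ _ ⟩
    ∑ n (λ i → f i + t * g i) + ∑ n (λ i → t * t * h i)  ≡⟨ cong₂ _+_ (∑-+ n _ _) (∑-*ˡ n _ _) ⟩
    ∑ n f + ∑ n (λ i → t * g i) + t * t * ∑ n h
      ≡⟨ cong (λ z → ∑ n f + z + t * t * ∑ n h) (∑-*ˡ n t g) ⟩
    ∑ n f + t * ∑ n g + t * t * ∑ n h                    ∎
    where open ≡-Reasoning

  infix 7 _·_
  _·_ : ∀ {n} → Vector n → Vector n → ℝ
  _·_ {n} x y = ∑ n (λ i → x i * y i)

  𝟏 : ∀ {n} → Vector n
  𝟏 _ = 1ℝ

module QuadraticForms (R : RealField) {n : ℕ} (A : Matrices.Matrix R n) where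
  open RealField R
  open IntegerCoefficients R
  open OrderedField R
  open FiniteSums R
  open Matrices R

  diag·𝟏 : diag A · 𝟏 ≡ tr A
  diag·𝟏 = ∑-cong n (λ i → *-identityʳ _)

  quadForm-𝟏 : quadForm A 𝟏 ≡ onesForm A
  quadForm-𝟏 = ∑-cong n (λ i → ∑-cong n (λ j → trans (*-identityʳ _) (*-identityˡ _)))

  quadForm-Rmat : ∀ x → let x₀ = head x ; y = tail x ; b = diag A · y in
    quadForm (Rmat A) x ≡ (x₀ + b) * (x₀ + b) + (quadForm A y - b * b)
  quadForm-Rmat x = begin
    quadForm (Rmat A) x                                ≡⟨⟩
    (x₀ * 1ℝ * x₀ + ∑ n (λ j → x₀ * A j j * y j))
      + ∑ n (λ i → y i * A i i * x₀ + ∑ n (λ j → y i * A i j * y j))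
      ≡⟨ cong₂ _+_ (cong (x₀ * 1ℝ * x₀ +_) row₀)
                   (trans (∑-+ n _ _) (cong (_+ quadForm A y) column₀)) ⟩
    (x₀ * 1ℝ * x₀ + x₀ * b) + (x₀ * b + quadForm A y)
      ≡⟨ solve 3 (λ x₀ b q → (x₀ :* con (pos 1) :* x₀ :+ x₀ :* b) :+ (x₀ :* b :+ q)
                             := (x₀ :+ b) :* (x₀ :+ b) :+ (q :- b :* b))
                 refl x₀ b (quadForm A y) ⟩
    (x₀ + b) * (x₀ + b) + (quadForm A y - b * b)       ∎
    where
    open ≡-Reasoning
    x₀ = head x
    y = tail x
    b = diag A · y

    row₀ : ∑ n (λ j → x₀ * A j j * y j) ≡ x₀ * b
    row₀ = trans (∑-cong n (λ j → *-assoc _ _ _)) (∑-*ˡ n x₀ _)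

    column₀ : ∑ n (λ i → y i * A i i * x₀) ≡ x₀ * b
    column₀ = trans (∑-cong n (λ i → solve 3 (λ y a x₀ → y :* a :* x₀ := x₀ :* (a :* y))
                                       refl _ _ _))
                    (∑-*ˡ n x₀ _)

  -- (aᵀy)² ≤ yᵀAy for all y, a = diag A: the Schur complement A − aaᵀ of
  -- the corner entry 1 of R(A) is positive semidefinite.
  SchurCondition : Set
  SchurCondition = ∀ y → (diag A · y) * (diag A · y) ≤ quadForm A y

  Rmat-PSD⇔ : PSD (Rmat A) ⇔ (Symmetric A × SchurCondition)
  Rmat-PSD⇔ = mk⇔ to from
    where
    to : PSD (Rmat A) → Symmetric A × SchurCondition
    to (symR , nonneg) = (λ i j → symR (suc i) (suc j)) , schur
      where
      -- test R(A) against x = (−aᵀy, y), which kills the square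
      schur : SchurCondition
      schur y = 0≤diff⇒≤ (subst (0ℝ ≤_)
        (trans (quadForm-Rmat (- b ∷ y))
               (solve 2 (λ b r → (:- b :+ b) :* (:- b :+ b) :+ r := r) refl b _))
        (nonneg (- b ∷ y)))
        where b = diag A · y

    from : Symmetric A × SchurCondition → PSD (Rmat A)
    from (symA , schur) = symR , λ x →
      subst (0ℝ ≤_) (sym (quadForm-Rmat x))
        (+-nonneg (square-nonneg _) (≤⇒0≤diff (schur (tail x))))
      where
      symR : Symmetric (Rmat A)
      symR zero    zero    = refl
      symR zero    (suc j) = refl
      symR (suc i) zero    = refl
      symR (suc i) (suc j) = symA i j

  quadForm-shift : Symmetric A → ∀ y t →
    quadForm A (λ i → y i + t) ≡
    quadForm A y + t * (y · mulOnes A + y · mulOnes A) + t * t * onesForm A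
  quadForm-shift symA y t = begin
    quadForm A (λ i → y i + t)
      ≡⟨ ∑-cong n (λ i → trans (∑-cong n (expand i)) (∑-quadratic n t _ _ _)) ⟩
    ∑ n (λ i → ∑ n (λ j → y i * A i j * y j) + t * ∑ n (cross i) + t * t * mulOnes A i)
      ≡⟨ ∑-quadratic n t _ _ _ ⟩
    quadForm A y + t * ∑ n (λ i → ∑ n (cross i)) + t * t * onesForm A
      ≡⟨ cong (λ z → quadForm A y + t * z + t * t * onesForm A) cross-terms ⟩
    quadForm A y + t * (y · mulOnes A + y · mulOnes A) + t * t * onesForm A ∎
    where
    open ≡-Reasoning
    cross : Fin n → Fin n → ℝ
    cross i j = y i * A i j + A i j * y j

    expand : ∀ i j → (y i + t) * A i j * (y j + t) ≡ y i * A i j * y j + t * cross i j + t * t * A i j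
    expand i j = solve 4 (λ a m b t → (a :+ t) :* m :* (b :+ t)
                                    := a :* m :* b :+ t :* (a :* m :+ m :* b) :+ t :* t :* m) refl _ _ _ _

    -- both halves of the cross term equal yᵀA𝟏, the second by symmetry
    cross-terms : ∑ n (λ i → ∑ n (cross i)) ≡ y · mulOnes A + y · mulOnes A
    cross-terms = begin
      ∑ n (λ i → ∑ n (cross i))
        ≡⟨ trans (∑-cong n (λ i → ∑-+ n _ _)) (∑-+ n _ _) ⟩
      ∑ n (λ i → ∑ n (λ j → y i * A i j)) + ∑ n (λ i → ∑ n (λ j → A i j * y j))
        ≡⟨ cong₂ _+_ (∑-cong n (λ i → ∑-*ˡ n (y i) _))
                     (trans (∑-swap n n _) (∑-cong n column)) ⟩
      y · mulOnes A + y · mulOnes A ∎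
      where
      column : ∀ j → ∑ n (λ i → A i j * y j) ≡ y j * mulOnes A j
      column j = trans (∑-cong n (λ i → trans (*-comm _ _) (cong (y j *_) (symA i j))))
                       (∑-*ˡ n (y j) _)

  -- The heart of (⇐): with diag A = c·A𝟏, A ⪰ 0 and tr(A)² ≤ 𝟏ᵀA𝟏 give the
  -- Schur condition (aᵀy)² ≤ yᵀAy, since aᵀy = c·yᵀA𝟏 and tr A = c·𝟏ᵀA𝟏.
  proportional-diagonal-schur : Symmetric A → ∀ c → (∀ i → diag A i ≡ c * mulOnes A i) →
    (∀ y → 0ℝ ≤ quadForm A y) → tr A * tr A ≤ onesForm A → SchurCondition
  proportional-diagonal-schur symA c diag≡c·A𝟏 nonneg trace-bound y =
    subst (λ b → b * b ≤ quadForm A y) (sym diag·y)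
      (quadratic-bound (quadForm A y) (y · mulOnes A) s c
        (λ t → subst (0ℝ ≤_) (quadForm-shift symA y t) (nonneg (λ i → y i + t)))
        (scaled-bound c s s≥0 (subst (λ r → r * r ≤ s) tr≡c·s trace-bound)))
    where
    s = onesForm A

    s≥0 : 0ℝ ≤ s
    s≥0 = subst (0ℝ ≤_) quadForm-𝟏 (nonneg 𝟏)

    tr≡c·s : tr A ≡ c * s
    tr≡c·s = trans (∑-cong n diag≡c·A𝟏) (∑-*ˡ n c (mulOnes A))

    diag·y : diag A · y ≡ c * (y · mulOnes A)
    diag·y = trans (∑-cong n (λ j → trans (cong (_* y j) (diag≡c·A𝟏 j))
                                   (trans (*-assoc _ _ _) (cong (c *_) (*-comm _ _)))))
                   (∑-*ˡ n c _)

open RealField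
open Matrices

mainTheorem4 : (R : RealField) (n : ℕ) (A : Matrix R n) → Symmetric R A →
    Σ (ℝ R) (λ c → ∀ i → diag R A i ≡ _*_ R c (mulOnes R A i)) →
    PSD R (Rmat R A) ⇔ (PSD R A × _≤_ R (_*_ R (tr R A) (tr R A)) (onesForm R A))
mainTheorem4 R n A symA (c , diag≡c·A𝟏) = mk⇔ to from
  where
  open OrderedField R
  open FiniteSums R
  open QuadraticForms R A

  -- (⇒) the Schur condition gives yᵀAy ≥ (aᵀy)² ≥ 0, and at y = 𝟏 it reads tr(A)² ≤ 𝟏ᵀA𝟏
  to : PSD R (Rmat R A) → PSD R A × _≤_ R (_*_ R (tr R A) (tr R A)) (onesForm R A)
  to psdR with Equivalence.to Rmat-PSD⇔ psdR
  ... | symA′ , schur =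
    (symA′ , λ y → ≤-trans (square-nonneg _) (schur y)) ,
    subst₂ (_≤_ R) (cong₂ (_*_ R) diag·𝟏 diag·𝟏) quadForm-𝟏 (schur 𝟏)

  from : PSD R A × _≤_ R (_*_ R (tr R A) (tr R A)) (onesForm R A) → PSD R (Rmat R A)
  from ((_ , nonneg) , trace-bound) = Equivalence.from Rmat-PSD⇔
    (symA , proportional-diagonal-schur symA c diag≡c·A𝟏 nonneg trace-bound)
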